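{- Let $t$ be a vsub-term. There is a $\mathsf{vsub}$-normalizing derivation $d$ from $t$ if and only if there is a $\mathsf{vsub}_k$-normalizing derivation $e$ from $\overline{t}$. Moreover, for such $d$ and $e$, $|d|_{\mathtt m}=|e|_{\mathtt m}$.
   Context: Value substitution calculus: vsub-terms $t,u::= v\mid tu\mid t[x\leftarrow u]$, vsub-values $v::=x\mid\lambda x.t$; $t[x\leftarrow u]$ binds $x$ in $t$; $t\{x\leftarrow u\}$ capture-avoiding substitution. Evaluation contexts $E::=\langle\cdot\rangle\mid tE\mid Et\mid E[x\leftarrow u]\mid t[x\leftarrow E]$; substitution contexts $L::=\langle\cdot\rangle\mid L[x\leftarrow u]$. $\to_{\mathtt m}$ is the closure under evaluation contexts of $L\langle\lambda x.t\rangle u\mapsto L\langle t[x\leftarrow u]\rangle$ and $\to_{\mathtt e}$ that of $t[x\leftarrow L\langle v\rangle]\mapsto L\langle t\{x\leftarrow v\}\rangle$ ($v$ vsub-value; bound variables of $L$ not free in $u$, resp. $t$); $\to_{\mathsf{vsub}}=\to_{\mathtt m}\cup\to_{\mathtt e}$. Vsub$_k$-terms: vsub-terms generated by $t,u::= v\mid tv\mid t[x\leftarrow u]$, $v::=x\mid\lambda x.t$; this set is closed under $\to_{\mathsf{vsub}}$, and $\to_{\mathsf{vsub}_k}$ is the restriction of $\to_{\mathsf{vsub}}$ to it. Translation: $\overline{x}=x$; $\overline{tu}=(\overline{t}\,x)[x\leftarrow\overline{u}]$ with $x$ fresh; $\overline{\lambda x.t}=\lambda x.\overline{t}$; $\overline{t[x\leftarrow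 u]}=\overline{t}[x\leftarrow\overline{u}]$. A derivation is normalizing if it ends in a normal form; $|d|_{\mathtt m}$ counts its $\mathtt m$-steps. -}

module Defs where

open import Data.Nat using (ℕ; zero; suc)
open import Data.Fin using (Fin; zero; suc)
open import Data.Product using (Σ; _×_; _,_)
open import Data.Sum using (_⊎_)
open import Relation.Nullary using (¬_)

-- Term n : terms with free variables among n variables.
-- esub t u  represents  t[x←u], where x is bound in t (de Bruijn index 0).
data Term (n : ℕ) : Set where
  var  : Fin n → Term n
  lam  : Term (suc n) → Term n
  app  : Term n → Term n → Term n
  esub : Term (suc n) → Term n → Term n

data Value {n : ℕ} : Term n → Set where
  vvar : (x : Fin n) → Value (var x)
  vlam : (t : Term (suc n)) → Value (lam t)

ext : ∀ {n m} → (Fin n → Fin m) → Fin (suc n) → Fin (suc m)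
ext ρ zero    = zero
ext ρ (suc i) = suc (ρ i)

ren : ∀ {n m} → (Fin n → Fin m) → Term n → Term m
ren ρ (var x)    = var (ρ x)
ren ρ (lam t)    = lam (ren (ext ρ) t)
ren ρ (app t u)  = app (ren ρ t) (ren ρ u)
ren ρ (esub t u) = esub (ren (ext ρ) t) (ren ρ u)

exts : ∀ {n m} → (Fin n → Term m) → Fin (suc n) → Term (suc m)
exts σ zero    = var zero
exts σ (suc i) = ren suc (σ i)

subst : ∀ {n m} → (Fin n → Term m) → Term n → Term m
subst σ (var x)    = σ x
subst σ (lam t)    = lam (subst (exts σ) t)
subst σ (app t u)  = app (subst σ t) (subst σ u)
subst σ (esub t u) = esub (subst (exts σ) t) (subst σ u)

sub0 : ∀ {n} → Term n → Fin (suc n) → Term n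
sub0 v zero    = v
sub0 v (suc i) = var i

_⟪_⟫ : ∀ {n} → Term (suc n) → Term n → Term n
t ⟪ v ⟫ = subst (sub0 v) t

-- substitution contexts  L ::= ⟨·⟩ | L[x←u]
-- SCtx n m : context whose hole sits under the binders of L (scope m),
-- while the whole term lives in scope n.
data SCtx : ℕ → ℕ → Set where
  hole : ∀ {n} → SCtx n n
  _[←_] : ∀ {n m} → SCtx (suc n) m → Term n → SCtx n m

plug : ∀ {n m} → SCtx n m → Term m → Term n
plug hole       t = t
plug (L [← u ]) t = esub (plug L t) u

-- the weakening of scope n into the scope m under L
-- (the variables bound by L are fresh w.r.t. terms from outside)
Lren : ∀ {n m} → SCtx n m → Fin n → Fin m
Lren hole       i = i
Lren (L [← u ]) i = Lren L (suc i)

data Kind : Set where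
  mul : Kind
  exs : Kind

data Root {n : ℕ} : Kind → Term n → Term n → Set where
  -- L⟨λx.t⟩u ↦ L⟨t[x←u]⟩
  rootM : ∀ {m} (L : SCtx n m) (t : Term (suc m)) (u : Term n) →
          Root mul (app (plug L (lam t)) u) (plug L (esub t (ren (Lren L) u)))
  -- t[x←L⟨v⟩] ↦ L⟨t{x←v}⟩
  rootE : ∀ {m} (t : Term (suc n)) (L : SCtx n m) (v : Term m) → Value v →
          Root exs (esub t (plug L v)) (plug L ((ren (ext (Lren L)) t) ⟪ v ⟫))

data Step {n : ℕ} (k : Kind) : Term n → Term n → Set where
  root  : ∀ {t u} → Root k t u → Step k t u
  appL  : ∀ {t t' u} → Step k t t' → Step k (app t u) (app t' u)
  appR  : ∀ {t u u'} → Step k u u' → Step k (app t u) (app t u')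
  esubL : ∀ {t t' u} → Step k t t' → Step k (esub t u) (esub t' u)
  esubR : ∀ {t u u'} → Step k u u' → Step k (esub t u) (esub t u')

LRel : Set₁
LRel = ∀ {n} → Kind → Term n → Term n → Set

VSub : LRel
VSub k t u = Step k t u

mutual
  data IsK {n : ℕ} : Term n → Set where
    kval  : ∀ {v} → IsKV v → IsK v
    kapp  : ∀ {t v} → IsK t → IsKV v → IsK (app t v)
    kesub : ∀ {t u} → IsK t → IsK u → IsK (esub t u)

  data IsKV {n : ℕ} : Term n → Set where
    kvar : (x : Fin n) → IsKV (var x)
    klam : ∀ {t} → IsK t → IsKV (lam t)

VSubK : LRel
VSubK k t u = IsK t × IsK u × Step k t u

data Deriv (R : LRel) {n : ℕ} : Term n → Term n → Set where
  done : ∀ {t} → Deriv R t t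
  step : ∀ {t u s} (k : Kind) → R k t u → Deriv R u s → Deriv R t s

countM : ∀ {R : LRel} {n} {t s : Term n} → Deriv R t s → ℕ
countM done              = zero
countM (step mul _ d)    = suc (countM d)
countM (step exs _ d)    = countM d

Normal : LRel → ∀ {n} → Term n → Set
Normal R t = ∀ k u → ¬ R k t u

NormDeriv : LRel → ∀ {n} → Term n → Set
NormDeriv R t = Σ _ λ s → Deriv R t s × Normal R s

tr : ∀ {n} → Term n → Term n
tr (var x)    = var x
tr (app t u)  = esub (app (ren suc (tr t)) (var zero)) (tr u)   -- (t̄ x)[x←ū], x fresh
tr (lam t)    = lam (tr t)
tr (esub t u) = esub (tr t) (tr u)

-- 1. →vsub has the diamond property; by random descent a weakly normalizing
--    term is bounded (every derivation from it has length at most N and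
--    extends to a normal form), and all its normalizing derivations have the
--    same number of m-steps.
-- 2. The shape relation t ~ p says that p follows the translation pattern
--    t u ↦ (p x)[x←q] up to names of free variables; t ~ tr t.  Simulation
--    lemma: if t ~ p and one side is bounded, both reduce to related normal
--    results by derivations with equally many m-steps; the extra steps on the
--    right are e-steps.  The proof is by induction on the bound and on ~.
-- 3. vsub_k-terms are closed under →vsub, so vsub_k-derivations from tr t are
--    exactly the vsub-derivations from it.
module Submission where

open import Defs
open import Data.Nat using (ℕ; zero; suc; _+_; _≤_; _<_; s≤s; z≤n)
open import Data.Nat.Properties using (≤-refl; ≤-trans; n≤1+n; suc-injective)
open import Data.Fin using (Fin; zero; suc)
open import Data.Product using (Σ; _×_; _,_; proj₁; proj₂)
open import Data.Sum using (_⊎_; inj₁; inj₂)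
open import Data.Empty using (⊥-elim)
open import Relation.Nullary using (¬_)
open import Relation.Binary.PropositionalEquality
  using (_≡_; _≗_; refl; sym; trans; cong; cong₂; module ≡-Reasoning)
  renaming (subst to transport)
open import Induction.WellFounded using (Acc; acc)
open import Data.Nat.Induction using (<-wellFounded)

ext-cong : ∀ {n m} {f g : Fin n → Fin m} → f ≗ g → ext f ≗ ext g
ext-cong e zero    = refl
ext-cong e (suc i) = cong suc (e i)

ren-cong : ∀ {n m} {f g : Fin n → Fin m} → f ≗ g → ren f ≗ ren g
ren-cong e (var x)    = cong var (e x)
ren-cong e (lam t)    = cong lam (ren-cong (ext-cong e) t)
ren-cong e (app t u)  = cong₂ app (ren-cong e t) (ren-cong e u)
ren-cong e (esub t u) = cong₂ esub (ren-cong (ext-cong e) t) (ren-cong e u)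

exts-cong : ∀ {n m} {σ τ : Fin n → Term m} → σ ≗ τ → exts σ ≗ exts τ
exts-cong e zero    = refl
exts-cong e (suc i) = cong (ren suc) (e i)

subst-cong : ∀ {n m} {σ τ : Fin n → Term m} → σ ≗ τ → subst σ ≗ subst τ
subst-cong e (var x)    = e x
subst-cong e (lam t)    = cong lam (subst-cong (exts-cong e) t)
subst-cong e (app t u)  = cong₂ app (subst-cong e t) (subst-cong e u)
subst-cong e (esub t u) = cong₂ esub (subst-cong (exts-cong e) t) (subst-cong e u)

ext-id : ∀ {n} → ext (λ (i : Fin n) → i) ≗ (λ i → i)
ext-id zero    = refl
ext-id (suc i) = refl

ren-id : ∀ {n} (t : Term n) → ren (λ i → i) t ≡ t
ren-id (var x)    = refl
ren-id (lam t)    = cong lam (trans (ren-cong ext-id t) (ren-id t))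
ren-id (app t u)  = cong₂ app (ren-id t) (ren-id u)
ren-id (esub t u) = cong₂ esub (trans (ren-cong ext-id t) (ren-id t)) (ren-id u)

ext-comp : ∀ {a b c} (f : Fin b → Fin c) (g : Fin a → Fin b) →
  (λ i → ext f (ext g i)) ≗ ext (λ i → f (g i))
ext-comp f g zero    = refl
ext-comp f g (suc i) = refl

ren-ren : ∀ {a b c} (f : Fin b → Fin c) (g : Fin a → Fin b) t →
  ren f (ren g t) ≡ ren (λ i → f (g i)) t
ren-ren f g (var x)    = refl
ren-ren f g (lam t)    = cong lam (trans (ren-ren (ext f) (ext g) t) (ren-cong (ext-comp f g) t))
ren-ren f g (app t u)  = cong₂ app (ren-ren f g t) (ren-ren f g u)
ren-ren f g (esub t u) =
  cong₂ esub (trans (ren-ren (ext f) (ext g) t) (ren-cong (ext-comp f g) t)) (ren-ren f g u)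

ren-exts : ∀ {a b c} (f : Fin b → Fin c) (σ : Fin a → Term b) →
  (λ i → ren (ext f) (exts σ i)) ≗ exts (λ i → ren f (σ i))
ren-exts f σ zero    = refl
ren-exts f σ (suc i) = trans (ren-ren (ext f) suc (σ i)) (sym (ren-ren suc f (σ i)))

ren-subst : ∀ {a b c} (f : Fin b → Fin c) (σ : Fin a → Term b) t →
  ren f (subst σ t) ≡ subst (λ i → ren f (σ i)) t
ren-subst f σ (var x)    = refl
ren-subst f σ (lam t)    =
  cong lam (trans (ren-subst (ext f) (exts σ) t) (subst-cong (ren-exts f σ) t))
ren-subst f σ (app t u)  = cong₂ app (ren-subst f σ t) (ren-subst f σ u)
ren-subst f σ (esub t u) =
  cong₂ esub (trans (ren-subst (ext f) (exts σ) t) (subst-cong (ren-exts f σ) t)) (ren-subst f σ u)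

exts-ext : ∀ {a b c} (σ : Fin b → Term c) (f : Fin a → Fin b) →
  (λ i → exts σ (ext f i)) ≗ exts (λ i → σ (f i))
exts-ext σ f zero    = refl
exts-ext σ f (suc i) = refl

subst-ren : ∀ {a b c} (σ : Fin b → Term c) (f : Fin a → Fin b) t →
  subst σ (ren f t) ≡ subst (λ i → σ (f i)) t
subst-ren σ f (var x)    = refl
subst-ren σ f (lam t)    =
  cong lam (trans (subst-ren (exts σ) (ext f) t) (subst-cong (exts-ext σ f) t))
subst-ren σ f (app t u)  = cong₂ app (subst-ren σ f t) (subst-ren σ f u)
subst-ren σ f (esub t u) =
  cong₂ esub (trans (subst-ren (exts σ) (ext f) t) (subst-cong (exts-ext σ f) t)) (subst-ren σ f u)

exts-exts : ∀ {a b c} (σ : Fin b → Term c) (τ : Fin a → Term b) →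
  (λ i → subst (exts σ) (exts τ i)) ≗ exts (λ i → subst σ (τ i))
exts-exts σ τ zero    = refl
exts-exts σ τ (suc i) = trans (subst-ren (exts σ) suc (τ i)) (sym (ren-subst suc σ (τ i)))

subst-subst : ∀ {a b c} (σ : Fin b → Term c) (τ : Fin a → Term b) t →
  subst σ (subst τ t) ≡ subst (λ i → subst σ (τ i)) t
subst-subst σ τ (var x)    = refl
subst-subst σ τ (lam t)    =
  cong lam (trans (subst-subst (exts σ) (exts τ) t) (subst-cong (exts-exts σ τ) t))
subst-subst σ τ (app t u)  = cong₂ app (subst-subst σ τ t) (subst-subst σ τ u)
subst-subst σ τ (esub t u) =
  cong₂ esub (trans (subst-subst (exts σ) (exts τ) t) (subst-cong (exts-exts σ τ) t)) (subst-subst σ τ u)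

exts-var : ∀ {n} → exts (var {n}) ≗ var
exts-var zero    = refl
exts-var (suc i) = refl

subst-var : ∀ {n} (t : Term n) → subst var t ≡ t
subst-var (var x)    = refl
subst-var (lam t)    = cong lam (trans (subst-cong exts-var t) (subst-var t))
subst-var (app t u)  = cong₂ app (subst-var t) (subst-var u)
subst-var (esub t u) = cong₂ esub (trans (subst-cong exts-var t) (subst-var t)) (subst-var u)

exts-ren : ∀ {a b} (f : Fin a → Fin b) → exts (λ i → var (f i)) ≗ (λ i → var (ext f i))
exts-ren f zero    = refl
exts-ren f (suc i) = refl

ren-as-subst : ∀ {a b} (f : Fin a → Fin b) t → ren f t ≡ subst (λ i → var (f i)) t
ren-as-subst f (var x)    = refl
ren-as-subst f (lam t)    =
  cong lam (trans (ren-as-subst (ext f) t) (sym (subst-cong (exts-ren f) t)))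
ren-as-subst f (app t u)  = cong₂ app (ren-as-subst f t) (ren-as-subst f u)
ren-as-subst f (esub t u) =
  cong₂ esub (trans (ren-as-subst (ext f) t) (sym (subst-cong (exts-ren f) t))) (ren-as-subst f u)

-- Plugging into a substitution context commutes with renaming: the context is
-- renamed, and its content is renamed by the lifting of the renaming under
-- the binders of the context.
record RenamedCtx (n' m : ℕ) : Set where
  constructor renamed
  field
    {renScope} : ℕ
    renCtx     : SCtx n' renScope
    renInner   : Fin m → Fin renScope
open RenamedCtx

renS : ∀ {n n' m} → (Fin n → Fin n') → SCtx n m → RenamedCtx n' m
renS f hole       = renamed hole f
renS f (L [← u ]) = renamed (renCtx r [← ren f u ]) (renInner r)
  where r = renS (ext f) L

ren-plug : ∀ {n n' m} (f : Fin n → Fin n') (L : SCtx n m) X →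
  ren f (plug L X) ≡ plug (renCtx (renS f L)) (ren (renInner (renS f L)) X)
ren-plug f hole       X = refl
ren-plug f (L [← u ]) X = cong (λ z → esub z (ren f u)) (ren-plug (ext f) L X)

record SubstitutedCtx (n' m : ℕ) : Set where
  constructor substituted
  field
    {subScope} : ℕ
    subCtx     : SCtx n' subScope
    subInner   : Fin m → Term subScope
open SubstitutedCtx

substS : ∀ {n n' m} → (Fin n → Term n') → SCtx n m → SubstitutedCtx n' m
substS σ hole       = substituted hole σ
substS σ (L [← u ]) = substituted (subCtx r [← subst σ u ]) (subInner r)
  where r = substS (exts σ) L

subst-plug : ∀ {n n' m} (σ : Fin n → Term n') (L : SCtx n m) X →
  subst σ (plug L X) ≡ plug (subCtx (substS σ L)) (subst (subInner (substS σ L)) X)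
subst-plug σ hole       X = refl
subst-plug σ (L [← u ]) X = cong (λ z → esub z (subst σ u)) (subst-plug (exts σ) L X)

subInner-Lren : ∀ {n n' m} (σ : Fin n → Term n') (L : SCtx n m) i →
  subInner (substS σ L) (Lren L i) ≡ ren (Lren (subCtx (substS σ L))) (σ i)
subInner-Lren σ hole       i = sym (ren-id (σ i))
subInner-Lren σ (L [← u ]) i =
  trans (subInner-Lren (exts σ) L (suc i)) (ren-ren (Lren (subCtx (substS (exts σ) L))) suc (σ i))

_⊕_ : ∀ {n m k} → SCtx n m → SCtx m k → SCtx n k
hole       ⊕ L₂ = L₂
(L [← u ]) ⊕ L₂ = (L ⊕ L₂) [← u ]

plug-⊕ : ∀ {n m k} (L : SCtx n m) (L₂ : SCtx m k) X → plug (L ⊕ L₂) X ≡ plug L (plug L₂ X)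
plug-⊕ hole       L₂ X = refl
plug-⊕ (L [← u ]) L₂ X = cong (λ z → esub z u) (plug-⊕ L L₂ X)

Lren-⊕ : ∀ {n m k} (L : SCtx n m) (L₂ : SCtx m k) i → Lren (L ⊕ L₂) i ≡ Lren L₂ (Lren L i)
Lren-⊕ hole       L₂ i = refl
Lren-⊕ (L [← u ]) L₂ i = Lren-⊕ L L₂ (suc i)

step-≡ : ∀ {n k} {a a' b b' : Term n} → a ≡ a' → b ≡ b' → Step k a b → Step k a' b'
step-≡ refl refl s = s

step-plug : ∀ {n m k} (L : SCtx n m) {a b} → Step k a b → Step k (plug L a) (plug L b)
step-plug hole       s = s
step-plug (L [← u ]) s = esubL (step-plug L s)

ValueSubst : ∀ {n m} → (Fin n → Term m) → Set
ValueSubst σ = ∀ i → Value (σ i)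

value-ren : ∀ {n m} (f : Fin n → Fin m) {v} → Value v → Value (ren f v)
value-ren f (vvar x) = vvar (f x)
value-ren f (vlam t) = vlam _

value-subst : ∀ {n m} {σ : Fin n → Term m} → ValueSubst σ → ∀ {v} → Value v → Value (subst σ v)
value-subst vσ (vvar x) = vσ x
value-subst vσ (vlam t) = vlam _

exts-value : ∀ {n m} {σ : Fin n → Term m} → ValueSubst σ → ValueSubst (exts σ)
exts-value vσ zero    = vvar zero
exts-value vσ (suc i) = value-ren suc (vσ i)

subInner-value : ∀ {n n' m} {σ : Fin n → Term n'} → ValueSubst σ → (L : SCtx n m) →
  ValueSubst (subInner (substS σ L))
subInner-value vσ hole       = vσ
subInner-value vσ (L [← u ]) = subInner-value (exts-value vσ) L

sub0-value : ∀ {n} {v : Term n} → Value v → ValueSubst (sub0 v)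
sub0-value vv zero    = vv
sub0-value vv (suc i) = vvar i

rootE-subst : ∀ {n n' m} (σ : Fin n → Term n') (L : SCtx n m) (t : Term (suc n)) (v : Term m) →
  let τ  = subInner (substS σ L)
      L' = subCtx (substS σ L)
  in subst τ ((ren (ext (Lren L)) t) ⟪ v ⟫) ≡ (ren (ext (Lren L')) (subst (exts σ) t)) ⟪ subst τ v ⟫
rootE-subst σ L t v = begin
  subst τ (subst (sub0 v) (ren (ext (Lren L)) t))
    ≡⟨ subst-subst τ (sub0 v) (ren (ext (Lren L)) t) ⟩
  subst (λ i → subst τ (sub0 v i)) (ren (ext (Lren L)) t)
    ≡⟨ subst-ren _ (ext (Lren L)) t ⟩
  subst (λ i → subst τ (sub0 v (ext (Lren L) i))) t
    ≡⟨ subst-cong pointwise t ⟩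
  subst (λ i → subst ρ (exts σ i)) t
    ≡⟨ sym (subst-subst ρ (exts σ) t) ⟩
  subst ρ (subst (exts σ) t)
    ≡⟨ sym (subst-ren (sub0 (subst τ v)) (ext (Lren L')) (subst (exts σ) t)) ⟩
  (ren (ext (Lren L')) (subst (exts σ) t)) ⟪ subst τ v ⟫ ∎
  where
  open ≡-Reasoning
  τ  = subInner (substS σ L)
  L' = subCtx (substS σ L)
  ρ  = λ j → sub0 (subst τ v) (ext (Lren L') j)
  pointwise : (λ i → subst τ (sub0 v (ext (Lren L) i))) ≗ (λ i → subst ρ (exts σ i))
  pointwise zero    = refl
  pointwise (suc i) = trans (subInner-Lren σ L i)
    (trans (ren-as-subst (Lren L') (σ i)) (sym (subst-ren ρ suc (σ i))))

step-subst : ∀ {n n' k} {σ : Fin n → Term n'} → ValueSubst σ → ∀ {t u} →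
  Step k t u → Step k (subst σ t) (subst σ u)
step-subst {σ = σ} vσ (root (rootM L s u)) =
  step-≡ (sym (cong (λ z → app z (subst σ u)) (subst-plug σ L (lam s))))
         (sym (trans (subst-plug σ L (esub s (ren (Lren L) u)))
                     (cong (λ z → plug L' (esub (subst (exts τ) s) z)) weakened-arg)))
         (root (rootM L' (subst (exts τ) s) (subst σ u)))
  where
  τ  = subInner (substS σ L)
  L' = subCtx (substS σ L)
  weakened-arg : subst τ (ren (Lren L) u) ≡ ren (Lren L') (subst σ u)
  weakened-arg = trans (subst-ren τ (Lren L) u)
    (trans (subst-cong (subInner-Lren σ L) u) (sym (ren-subst (Lren L') σ u)))
step-subst {σ = σ} vσ (root (rootE t L v vv)) =
  step-≡ (sym (cong (esub (subst (exts σ) t)) (subst-plug σ L v)))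
         (sym (trans (subst-plug σ L ((ren (ext (Lren L)) t) ⟪ v ⟫))
                     (cong (plug (subCtx (substS σ L))) (rootE-subst σ L t v))))
         (root (rootE (subst (exts σ) t) (subCtx (substS σ L)) (subst (subInner (substS σ L)) v)
                      (value-subst (subInner-value vσ L) vv)))
step-subst vσ (appL s)  = appL (step-subst vσ s)
step-subst vσ (appR s)  = appR (step-subst vσ s)
step-subst vσ (esubL s) = esubL (step-subst (exts-value vσ) s)
step-subst vσ (esubR s) = esubR (step-subst vσ s)

step-ren : ∀ {n n' k} (f : Fin n → Fin n') {t u} → Step k t u → Step k (ren f t) (ren f u)
step-ren f {t} {u} s =
  step-≡ (sym (ren-as-subst f t)) (sym (ren-as-subst f u)) (step-subst (λ i → vvar (f i)) s)

record StepMap (a b : ℕ) : Set where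
  constructor stepMap
  field
    apply    : Term a → Term b
    map-step : ∀ {k x y} → Step k x y → Step k (apply x) (apply y)
open StepMap

inPlug : ∀ {n m} → SCtx n m → StepMap m n
inPlug L = stepMap (plug L) (step-plug L)

inAppL : ∀ {n} → Term n → StepMap n n
inAppL u = stepMap (λ x → app x u) appL

inAppR : ∀ {n} → Term n → StepMap n n
inAppR t = stepMap (app t) appR

inEsubL : ∀ {n} → Term n → StepMap (suc n) n
inEsubL u = stepMap (λ x → esub x u) esubL

inEsubR : ∀ {n} → Term (suc n) → StepMap n n
inEsubR t = stepMap (esub t) esubR

-- Steps out of an answer L⟨v⟩ take place inside the substitution context L,
-- and they act uniformly on the content of the hole: the reduct is
-- L'⟨vσ⟩ for a value substitution σ that leaves the variables of L alone, and
-- the same step turns L⟨X⟩ into L'⟨Xσ⟩ for every X.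

value-normal : ∀ {n k} {v y : Term n} → Value v → ¬ Step k v y
value-normal (vvar x) (root ())
value-normal (vlam t) (root ())

record AnswerStep {n m} (k : Kind) (L : SCtx n m) (v : Term m) (y : Term n) : Set where
  field
    {scope}   : ℕ
    ctx'      : SCtx n scope
    σ         : Fin m → Term scope
    σ-value   : ValueSubst σ
    σ-outer   : ∀ i → σ (Lren L i) ≡ var (Lren ctx' i)
    reduct    : y ≡ plug ctx' (subst σ v)
    uniform   : ∀ X → Step k (plug L X) (plug ctx' (subst σ X))
open AnswerStep

answer-step : ∀ {n m k} (L : SCtx n m) {v : Term m} {y} → Value v → Step k (plug L v) y →
  AnswerStep k L v y
answer-step hole vv s = ⊥-elim (value-normal vv s)
answer-step (L [← u ]) vv (esubL s) = record
  { ctx' = ctx' a [← u ] ; σ = σ a ; σ-value = σ-value a ; σ-outer = λ i → σ-outer a (suc i)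
  ; reduct = cong (λ z → esub z u) (reduct a) ; uniform = λ X → esubL (uniform a X) }
  where a = answer-step L vv s
answer-step (L [← u ]) {v} vv (esubR {u' = u'} s) = record
  { ctx' = L [← u' ] ; σ = var ; σ-value = vvar ; σ-outer = λ i → refl
  ; reduct = cong (λ z → esub (plug L z) u') (sym (subst-var v))
  ; uniform = λ X → step-≡ refl (cong (λ z → esub (plug L z) u') (sym (subst-var X))) (esubR s) }
answer-step (L [← _ ]) {v} vv (root (rootE _ L₃ w vw)) = record
  { ctx' = L₃ ⊕ subCtx r ; σ = subInner r ; σ-value = subInner-value τ-value L
  ; σ-outer = λ i → trans (subInner-Lren τ L (suc i)) (cong var (sym (Lren-⊕ L₃ (subCtx r) i)))
  ; reduct = contractum v
  ; uniform = λ X → step-≡ refl (contractum X) (root (rootE (plug L X) L₃ w vw)) }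
  where
  τ = λ j → sub0 w (ext (Lren L₃) j)
  τ-value : ValueSubst τ
  τ-value zero    = vw
  τ-value (suc i) = vvar _
  r = substS τ L
  contractum : ∀ X → plug L₃ ((ren (ext (Lren L₃)) (plug L X)) ⟪ w ⟫) ≡ plug (L₃ ⊕ subCtx r) (subst (subInner r) X)
  contractum X = trans (cong (plug L₃) (trans (subst-ren (sub0 w) (ext (Lren L₃)) (plug L X)) (subst-plug τ L X)))
                       (sym (plug-⊕ L₃ (subCtx r) _))

Joinable : ∀ {n} → Kind → Kind → Term n → Term n → Set
Joinable k₁ k₂ u₁ u₂ = (k₁ ≡ k₂ × u₁ ≡ u₂) ⊎ Σ _ λ s → Step k₂ u₁ s × Step k₁ u₂ s

esub-injective : ∀ {n} {a a' : Term (suc n)} {b b'} → esub a b ≡ esub a' b' → a ≡ a' × b ≡ b'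
esub-injective refl = refl , refl

app-injective : ∀ {n} {a a' b b' : Term n} → app a b ≡ app a' b' → a ≡ a' × b ≡ b'
app-injective refl = refl , refl

-- A term L⟨λx.s⟩ determines L and s, hence the multiplicative contractum;
-- the renaming g keeps track of the binders of L already traversed.
contractumM-unique : ∀ {n m m' a} (L : SCtx n m) (L' : SCtx n m') {s s'} (g : Fin a → Fin n) (u : Term a) →
  plug L (lam s) ≡ plug L' (lam s') →
  plug L (esub s (ren (λ i → Lren L (g i)) u)) ≡ plug L' (esub s' (ren (λ i → Lren L' (g i)) u))
contractumM-unique hole       hole         g u refl = refl
contractumM-unique hole       (L' [← _ ])  g u ()
contractumM-unique (L [← _ ]) hole         g u ()
contractumM-unique (L [← c ]) (L' [← c' ]) g u eq with esub-injective eq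
... | eq₁ , refl = cong (λ z → esub z c) (contractumM-unique L L' (λ i → suc (g i)) u eq₁)

contractumE-unique : ∀ {n m m' a} (L : SCtx n m) (L' : SCtx n m') {v v'} → Value v → Value v' →
  (g : Fin a → Fin n) (t : Term (suc a)) → plug L v ≡ plug L' v' →
  plug L ((ren (ext (λ i → Lren L (g i))) t) ⟪ v ⟫) ≡ plug L' ((ren (ext (λ i → Lren L' (g i))) t) ⟪ v' ⟫)
contractumE-unique hole       hole         vv       vv'      g t refl = refl
contractumE-unique hole       (L' [← _ ])  (vvar _) vv'      g t ()
contractumE-unique hole       (L' [← _ ])  (vlam _) vv'      g t ()
contractumE-unique (L [← _ ]) hole         vv       (vvar _) g t ()
contractumE-unique (L [← _ ]) hole         vv       (vlam _) g t ()
contractumE-unique (L [← c ]) (L' [← c' ]) vv       vv'      g t eq with esub-injective eq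
... | eq₁ , refl = cong (λ z → esub z c) (contractumE-unique L L' vv vv' (λ i → suc (g i)) t eq₁)

root-deterministic : ∀ {n k₁ k₂} {T u₁ u₂ : Term n} → Root k₁ T u₁ → Root k₂ T u₂ → k₁ ≡ k₂ × u₁ ≡ u₂
root-deterministic (rootM L s u) r₂ = fromM r₂ refl
  where
  fromM : ∀ {k₂ T u₂} → Root k₂ T u₂ → T ≡ app (plug L (lam s)) u → mul ≡ k₂ × plug L (esub s (ren (Lren L) u)) ≡ u₂
  fromM (rootM L' s' u') eq with app-injective eq
  ... | eq₁ , refl = refl , contractumM-unique L L' (λ i → i) u (sym eq₁)
  fromM (rootE _ _ _ _) ()
root-deterministic (rootE t L v vv) r₂ = fromE r₂ refl
  where
  fromE : ∀ {k₂ T u₂} → Root k₂ T u₂ → T ≡ esub t (plug L v) → exs ≡ k₂ × plug L ((ren (ext (Lren L)) t) ⟪ v ⟫) ≡ u₂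
  fromE (rootM _ _ _) ()
  fromE (rootE t' L' v' vv') eq with esub-injective eq
  ... | refl , eq₂ = refl , contractumE-unique L L' vv vv' (λ i → i) t (sym eq₂)

Closes : ∀ {n} → Kind → Kind → Term n → Term n → Set
Closes k₁ k₂ u₁ u₂ = Σ _ λ s → Step k₂ u₁ s × Step k₁ u₂ s

root-appL : ∀ {n k₁ k₂} {a c u₁ a' : Term n} → Root k₁ (app a c) u₁ → Step k₂ a a' →
  Closes k₁ k₂ u₁ (app a' c)
root-appL (rootM L s u) b = _ ,
  step-≡ refl (cong (λ z → plug (ctx' a) (esub (subst (exts (σ a)) s) z)) weakened-arg)
         (uniform a (esub s (ren (Lren L) u))) ,
  step-≡ (cong (λ z → app z u) (sym (reduct a))) refl (root (rootM (ctx' a) (subst (exts (σ a)) s) u))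
  where
  a = answer-step L (vlam s) b
  weakened-arg : subst (σ a) (ren (Lren L) u) ≡ ren (Lren (ctx' a)) u
  weakened-arg = trans (subst-ren (σ a) (Lren L) u)
    (trans (subst-cong (σ-outer a) u) (sym (ren-as-subst (Lren (ctx' a)) u)))

root-appR : ∀ {n k₁ k₂} {a c u₁ c' : Term n} → Root k₁ (app a c) u₁ → Step k₂ c c' →
  Closes k₁ k₂ u₁ (app a c')
root-appR (rootM L s u) b = _ , step-plug L (esubR (step-ren (Lren L) b)) , root (rootM L s _)

root-esubL : ∀ {n k₁ k₂} {a a' : Term (suc n)} {c u₁ : Term n} → Root k₁ (esub a c) u₁ → Step k₂ a a' →
  Closes k₁ k₂ u₁ (esub a' c)
root-esubL (rootE t L v vv) b =
  _ , step-plug L (step-subst (sub0-value vv) (step-ren (ext (Lren L)) b)) , root (rootE _ L v vv)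

root-esubR : ∀ {n k₁ k₂} {a : Term (suc n)} {c u₁ c' : Term n} → Root k₁ (esub a c) u₁ → Step k₂ c c' →
  Closes k₁ k₂ u₁ (esub a c')
root-esubR (rootE t L v vv) b = _ ,
  step-≡ refl (cong (plug (ctx' a)) contractum) (uniform a ((ren (ext (Lren L)) t) ⟪ v ⟫)) ,
  step-≡ (cong (esub t) (sym (reduct a))) refl
         (root (rootE t (ctx' a) (subst (σ a) v) (value-subst (σ-value a) vv)))
  where
  a = answer-step L vv b
  pointwise : (λ i → subst (σ a) (sub0 v (ext (Lren L) i))) ≗ (λ i → sub0 (subst (σ a) v) (ext (Lren (ctx' a)) i))
  pointwise zero    = refl
  pointwise (suc i) = σ-outer a i
  contractum : subst (σ a) ((ren (ext (Lren L)) t) ⟪ v ⟫) ≡ (ren (ext (Lren (ctx' a))) t) ⟪ subst (σ a) v ⟫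
  contractum = trans (subst-subst (σ a) (sub0 v) (ren (ext (Lren L)) t))
    (trans (subst-ren _ (ext (Lren L)) t)
    (trans (subst-cong pointwise t) (sym (subst-ren (sub0 (subst (σ a) v)) (ext (Lren (ctx' a))) t))))

flip : ∀ {n k₁ k₂} {u₁ u₂ : Term n} → Closes k₁ k₂ u₁ u₂ → Closes k₂ k₁ u₂ u₁
flip (s , a , b) = s , b , a

congruent : ∀ {a b k₁ k₂} (F : StepMap a b) {u₁ u₂} → Joinable k₁ k₂ u₁ u₂ →
  Joinable k₁ k₂ (apply F u₁) (apply F u₂)
congruent F (inj₁ (refl , refl))  = inj₁ (refl , refl)
congruent F (inj₂ (s , p , q)) = inj₂ (_ , map-step F p , map-step F q)

diamond : ∀ {n k₁ k₂} {t u₁ u₂ : Term n} → Step k₁ t u₁ → Step k₂ t u₂ → Joinable k₁ k₂ u₁ u₂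
diamond (root r₁) (root r₂)  = inj₁ (root-deterministic r₁ r₂)
diamond (root r)  (appL b)   = inj₂ (root-appL r b)
diamond (root r)  (appR b)   = inj₂ (root-appR r b)
diamond (root r)  (esubL b)  = inj₂ (root-esubL r b)
diamond (root r)  (esubR b)  = inj₂ (root-esubR r b)
diamond (appL b)  (root r)   = inj₂ (flip (root-appL r b))
diamond (appR b)  (root r)   = inj₂ (flip (root-appR r b))
diamond (esubL b) (root r)   = inj₂ (flip (root-esubL r b))
diamond (esubR b) (root r)   = inj₂ (flip (root-esubR r b))
diamond (appL a)  (appL b)   = congruent (inAppL _) (diamond a b)
diamond (appL a)  (appR b)   = inj₂ (_ , appR b , appL a)
diamond (appR a)  (appL b)   = inj₂ (_ , appL b , appR a)
diamond (appR a)  (appR b)   = congruent (inAppR _) (diamond a b)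
diamond (esubL a) (esubL b)  = congruent (inEsubL _) (diamond a b)
diamond (esubL a) (esubR b)  = inj₂ (_ , esubR b , esubL a)
diamond (esubR a) (esubL b)  = inj₂ (_ , esubL b , esubR a)
diamond (esubR a) (esubR b)  = congruent (inEsubR _) (diamond a b)

infix 2 _⟶*_
_⟶*_ : ∀ {n} → Term n → Term n → Set
_⟶*_ = Deriv VSub

length : ∀ {R : LRel} {n} {t s : Term n} → Deriv R t s → ℕ
length done         = zero
length (step k r d) = suc (length d)

weight : Kind → ℕ
weight mul = 1
weight exs = 0

countM-step : ∀ {R : LRel} {n} (k : Kind) {t u s : Term n} (r : R k t u) (d : Deriv R u s) →
  countM (step k r d) ≡ weight k + countM d
countM-step mul r d = refl
countM-step exs r d = refl

weight-swap : ∀ k₁ k₂ c → weight k₁ + (weight k₂ + c) ≡ weight k₂ + (weight k₁ + c)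
weight-swap mul mul c = refl
weight-swap mul exs c = refl
weight-swap exs mul c = refl
weight-swap exs exs c = refl

-- By the diamond property, if t reaches a normal form by a
-- derivation d, then after any step t → u the term u reaches a normal form by
-- a derivation d' that is one step shorter and has the m-steps of d, minus
-- the one just performed.
record Descent {n} (k : Kind) (u : Term n) (d-length d-count : ℕ) : Set where
  constructor descent
  field
    {target}     : Term n
    residual     : u ⟶* target
    normal       : Normal VSub target
    shorter      : suc (length residual) ≡ d-length
    same-m-count : weight k + countM residual ≡ d-count

random-descent : ∀ {n k} {t s u : Term n} (d : t ⟶* s) → Normal VSub s → Step k t u →
  Descent k u (length d) (countM d)
random-descent done ns b = ⊥-elim (ns _ _ b)
random-descent {k = k} (step k₁ a d₁) ns b with diamond a b
... | inj₁ (refl , refl) = descent d₁ ns refl (sym (countM-step k a d₁))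
... | inj₂ (_ , c₁ , c₂) with random-descent d₁ ns c₁
...   | descent d₂ ns₂ l c = descent (step k₁ c₂ d₂) ns₂ (cong suc l)
  (trans (cong (weight k +_) (countM-step k₁ c₂ d₂))
  (trans (weight-swap k k₁ (countM d₂))
  (trans (cong (weight k₁ +_) c) (sym (countM-step k₁ a d₁)))))

countM-unique : ∀ {n} {t s s' : Term n} (d : t ⟶* s) (e : t ⟶* s') →
  Normal VSub s → Normal VSub s' → countM d ≡ countM e
countM-unique done         done       ns ns' = refl
countM-unique (step k a d) done       ns ns' = ⊥-elim (ns' _ _ a)
countM-unique d            (step k b e) ns ns' with random-descent d ns b
... | descent d' ns'' _ c =
  trans (sym c) (trans (cong (weight k +_) (countM-unique d' e ns'' ns')) (sym (countM-step k b e)))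

-- Weak normalization implies boundedness (random
-- descent), which gives the measure for the simulation argument.
Bounded : ∀ {n} → ℕ → Term n → Set
Bounded zero    t = Normal VSub t
Bounded (suc N) t = ∀ k u → Step k t u → Bounded N u

normalizing⇒bounded : ∀ {n} {t s : Term n} (d : t ⟶* s) → Normal VSub s → Bounded (length d) t
normalizing⇒bounded d ns = go _ d ns refl
  where
  go : ∀ {n} N {t s : Term n} (d : t ⟶* s) → Normal VSub s → length d ≡ N → Bounded N t
  go zero    done ns refl = ns
  go (suc N) d    ns eq k u b with random-descent d ns b
  ... | descent d' ns' l _ = go N d' ns' (suc-injective (trans l eq))

normal⇒bounded : ∀ {n} {t : Term n} → Normal VSub t → ∀ N → Bounded N t
normal⇒bounded h zero    = h
normal⇒bounded h (suc N) k u st = ⊥-elim (h k u st)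

bounded-mono : ∀ {n} {N N'} {t : Term n} → N ≤ N' → Bounded N t → Bounded N' t
bounded-mono {N' = N'} z≤n h = normal⇒bounded h N'
bounded-mono (s≤s p) h k u st = bounded-mono p (h k u st)

bounded-unmap : ∀ {a b} N (F : StepMap a b) {x} → Bounded N (apply F x) → Bounded N x
bounded-unmap zero    F h k u st = h k _ (map-step F st)
bounded-unmap (suc N) F h k u st = bounded-unmap N F (h k _ (map-step F st))

bounded-step : ∀ {n N k} {t u : Term n} → Bounded N t → Step k t u → Σ ℕ λ N' → N' < N × Bounded N' u
bounded-step {N = zero}  h st = ⊥-elim (h _ _ st)
bounded-step {N = suc N} h st = N , ≤-refl , h _ _ st

bounded-deriv : ∀ {n N} {t s : Term n} → Bounded N t → t ⟶* s → Σ ℕ λ N' → N' ≤ N × Bounded N' s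
bounded-deriv {N = N} h done = N , ≤-refl , h
bounded-deriv h (step k a d) with bounded-step h a
... | N₁ , lt , h₁ with bounded-deriv h₁ d
...   | N₂ , le , h₂ = N₂ , ≤-trans le (≤-trans (n≤1+n N₁) lt) , h₂

_++_ : ∀ {n} {a b c : Term n} → a ⟶* b → b ⟶* c → a ⟶* c
done         ++ e = e
step k r d   ++ e = step k r (d ++ e)

countM-++ : ∀ {n} {a b c : Term n} (d : a ⟶* b) (e : b ⟶* c) → countM (d ++ e) ≡ countM d + countM e
countM-++ done           e = refl
countM-++ (step mul r d) e = cong suc (countM-++ d e)
countM-++ (step exs r d) e = countM-++ d e

map-deriv : ∀ {a b} (F : StepMap a b) {x y} → x ⟶* y → apply F x ⟶* apply F y
map-deriv F done         = done
map-deriv F (step k r d) = step k (map-step F r) (map-deriv F d)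

countM-map : ∀ {a b} (F : StepMap a b) {x y} (d : x ⟶* y) → countM (map-deriv F d) ≡ countM d
countM-map F done           = refl
countM-map F (step mul r d) = cong suc (countM-map F d)
countM-map F (step exs r d) = countM-map F d

record Sync {m m'} (t s : Term m) (p q : Term m') : Set where
  constructor sync
  field
    left   : t ⟶* s
    right  : p ⟶* q
    same-m : countM left ≡ countM right
open Sync

infixr 5 _▹_
_▹_ : ∀ {m m'} {t s s' : Term m} {p q q' : Term m'} → Sync t s p q → Sync s s' q q' → Sync t s' p q'
sync d e c ▹ sync d' e' c' =
  sync (d ++ d') (e ++ e') (trans (countM-++ d d') (trans (cong₂ _+_ c c') (sym (countM-++ e e'))))

sync-map : ∀ {a b a' b'} (F : StepMap a b) (G : StepMap a' b') {t s p q} → Sync t s p q →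
  Sync (apply F t) (apply F s) (apply G p) (apply G q)
sync-map F G (sync d e c) =
  sync (map-deriv F d) (map-deriv G e) (trans (countM-map F d) (trans c (sym (countM-map G e))))

sync-≡ : ∀ {m m'} {t s s' : Term m} {p q q' : Term m'} → s ≡ s' → q ≡ q' → Sync t s p q → Sync t s' p q'
sync-≡ refl refl x = x

-- The termination measure of the simulation: one of the two related terms is
-- bounded by N.
EitherBounded : ∀ {m m'} → ℕ → Term m → Term m' → Set
EitherBounded N t p = Bounded N t ⊎ Bounded N p

either-deriv : ∀ {m m' N} {t s : Term m} {p q : Term m'} → EitherBounded N t p →
  t ⟶* s → p ⟶* q → EitherBounded N s q
either-deriv (inj₁ h) d e with bounded-deriv h d
... | _ , le , h' = inj₁ (bounded-mono le h')
either-deriv (inj₂ h) d e with bounded-deriv h e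
... | _ , le , h' = inj₂ (bounded-mono le h')

bounded-after : ∀ {n N} {t s : Term n} → Bounded N t → (d : t ⟶* s) → 0 < length d →
  Σ ℕ λ N' → N' < N × Bounded N' s
bounded-after h (step k a d) _ with bounded-step h a
... | N₁ , lt , h₁ with bounded-deriv h₁ d
...   | N₂ , le , h₂ = N₂ , ≤-trans (s≤s le) lt , h₂

either-advance : ∀ {m m' N} {t s : Term m} {p q : Term m'} → EitherBounded N t p →
  (d : t ⟶* s) → 0 < length d → (e : p ⟶* q) → 0 < length e →
  Σ ℕ λ N' → N' < N × EitherBounded N' s q
either-advance (inj₁ h) d nd e ne with bounded-after h d nd
... | N' , lt , h' = N' , lt , inj₁ h'
either-advance (inj₂ h) d nd e ne with bounded-after h e ne
... | N' , lt , h' = N' , lt , inj₂ h'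

either-unmap : ∀ {a b a' b' N} (F : StepMap a b) (G : StepMap a' b') {x y} →
  EitherBounded N (apply F x) (apply G y) → EitherBounded N x y
either-unmap {N = N} F G (inj₁ h) = inj₁ (bounded-unmap N F h)
either-unmap {N = N} F G (inj₂ h) = inj₂ (bounded-unmap N G h)

-- The shape relation.  'Shape r t p' says that p is obtained from t by the
-- translation pattern  t u ↦ (p x)[x←q]  at every application, up to the
-- names of free variables: the scope relation r records which binders of t
-- and p correspond, while any two variables bound outside r are related.

-- the translation pattern of an application:  (p x)[x←q]  with x fresh
trApp : ∀ {m} → Term m → Term m → Term m
trApp p q = esub (app (ren suc p) (var zero)) q

data Scope : ℕ → ℕ → Set where
  free : ∀ {m m'} → Scope m m'
  bind : ∀ {m m'} → Scope m m' → Scope (suc m) (suc m')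

data VarRel : ∀ {m m'} → Scope m m' → Fin m → Fin m' → Set where
  any-free : ∀ {m m'} {x : Fin m} {y : Fin m'} → VarRel free x y
  bound    : ∀ {m m'} {r : Scope m m'} → VarRel (bind r) zero zero
  shifted  : ∀ {m m'} {r : Scope m m'} {x y} → VarRel r x y → VarRel (bind r) (suc x) (suc y)

data Shape : ∀ {m m'} → Scope m m' → Term m → Term m' → Set where
  shape-var  : ∀ {m m'} {r : Scope m m'} {x y} → VarRel r x y → Shape r (var x) (var y)
  shape-lam  : ∀ {m m'} {r : Scope m m'} {s s'} → Shape (bind r) s s' → Shape r (lam s) (lam s')
  shape-app  : ∀ {m m'} {r : Scope m m'} {t p u q} → Shape r t p → Shape r u q →
               Shape r (app t u) (trApp p q)
  shape-esub : ∀ {m m'} {r : Scope m m'} {t p u q} → Shape (bind r) t p → Shape r u q →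
               Shape r (esub t u) (esub p q)

VarMap : ∀ {m₁ m₁' m₂ m₂'} → Scope m₁ m₁' → Scope m₂ m₂' → (Fin m₁ → Fin m₂) → (Fin m₁' → Fin m₂') → Set
VarMap r₁ r₂ f g = ∀ {x y} → VarRel r₁ x y → VarRel r₂ (f x) (g y)

SubstRel : ∀ {m₁ m₁' m₂ m₂'} → Scope m₁ m₁' → Scope m₂ m₂' → (Fin m₁ → Term m₂) → (Fin m₁' → Term m₂') → Set
SubstRel r₁ r₂ σ σ' = ∀ {x y} → VarRel r₁ x y → Shape r₂ (σ x) (σ' y)

ext-VarMap : ∀ {m₁ m₁' m₂ m₂'} {r₁ : Scope m₁ m₁'} {r₂ : Scope m₂ m₂'} {f g} →
  VarMap r₁ r₂ f g → VarMap (bind r₁) (bind r₂) (ext f) (ext g)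
ext-VarMap H bound       = bound
ext-VarMap H (shifted h) = shifted (H h)

shape-ren : ∀ {m₁ m₁' m₂ m₂'} {r₁ : Scope m₁ m₁'} {r₂ : Scope m₂ m₂'} (f : Fin m₁ → Fin m₂) (g : Fin m₁' → Fin m₂') →
  VarMap r₁ r₂ f g → ∀ {t p} → Shape r₁ t p → Shape r₂ (ren f t) (ren g p)
shape-ren f g H (shape-var h)    = shape-var (H h)
shape-ren f g H (shape-lam h)    = shape-lam (shape-ren (ext f) (ext g) (ext-VarMap H) h)
shape-ren {r₂ = r₂} f g H (shape-app {p = p} {q = q} h₁ h₂) =
  transport (λ z → Shape r₂ _ (esub (app z (var zero)) (ren g q)))
    (trans (ren-ren suc g p) (sym (ren-ren (ext g) suc p)))
    (shape-app (shape-ren f g H h₁) (shape-ren f g H h₂))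
shape-ren f g H (shape-esub h₁ h₂) = shape-esub (shape-ren (ext f) (ext g) (ext-VarMap H) h₁) (shape-ren f g H h₂)

exts-SubstRel : ∀ {m₁ m₁' m₂ m₂'} {r₁ : Scope m₁ m₁'} {r₂ : Scope m₂ m₂'} {σ σ'} →
  SubstRel r₁ r₂ σ σ' → SubstRel (bind r₁) (bind r₂) (exts σ) (exts σ')
exts-SubstRel H bound       = shape-var bound
exts-SubstRel H (shifted h) = shape-ren suc suc shifted (H h)

shape-subst : ∀ {m₁ m₁' m₂ m₂'} {r₁ : Scope m₁ m₁'} {r₂ : Scope m₂ m₂'} (σ : Fin m₁ → Term m₂) (σ' : Fin m₁' → Term m₂') →
  SubstRel r₁ r₂ σ σ' → ∀ {t p} → Shape r₁ t p → Shape r₂ (subst σ t) (subst σ' p)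
shape-subst σ σ' H (shape-var h) = H h
shape-subst σ σ' H (shape-lam h) = shape-lam (shape-subst (exts σ) (exts σ') (exts-SubstRel H) h)
shape-subst {r₂ = r₂} σ σ' H (shape-app {p = p} {q = q} h₁ h₂) =
  transport (λ z → Shape r₂ _ (esub (app z (var zero)) (subst σ' q)))
    (trans (ren-subst suc σ' p) (sym (subst-ren (exts σ') suc p)))
    (shape-app (shape-subst σ σ' H h₁) (shape-subst σ σ' H h₂))
shape-subst σ σ' H (shape-esub h₁ h₂) =
  shape-esub (shape-subst (exts σ) (exts σ') (exts-SubstRel H) h₁) (shape-subst σ σ' H h₂)

shape-renʳ : ∀ {m m₁' m₂'} {r₁ : Scope m m₁'} {r₂ : Scope m m₂'} (g : Fin m₁' → Fin m₂') →
  VarMap r₁ r₂ (λ x → x) g → ∀ {t p} → Shape r₁ t p → Shape r₂ t (ren g p)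
shape-renʳ {r₂ = r₂} g H {t} {p} h = transport (λ z → Shape r₂ z (ren g p)) (ren-id t) (shape-ren (λ i → i) g H h)

shape-substʳ : ∀ {m m₁' m₂'} {r₁ : Scope m m₁'} {r₂ : Scope m m₂'} (σ' : Fin m₁' → Term m₂') →
  SubstRel r₁ r₂ var σ' → ∀ {t p} → Shape r₁ t p → Shape r₂ t (subst σ' p)
shape-substʳ {r₂ = r₂} σ' H {t} {p} h = transport (λ z → Shape r₂ z (subst σ' p)) (subst-var t) (shape-subst var σ' H h)

VarIncl : ∀ {m m'} → Scope m m' → Scope m m' → Set
VarIncl r₁ r₂ = ∀ {x y} → VarRel r₁ x y → VarRel r₂ x y

bind-VarIncl : ∀ {m m'} {r₁ r₂ : Scope m m'} → VarIncl r₁ r₂ → VarIncl (bind r₁) (bind r₂)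
bind-VarIncl H bound       = bound
bind-VarIncl H (shifted h) = shifted (H h)

shape-weaken : ∀ {m m'} {r₁ r₂ : Scope m m'} → VarIncl r₁ r₂ → ∀ {t p} → Shape r₁ t p → Shape r₂ t p
shape-weaken H (shape-var h)      = shape-var (H h)
shape-weaken H (shape-lam h)      = shape-lam (shape-weaken (bind-VarIncl H) h)
shape-weaken H (shape-app h₁ h₂)  = shape-app (shape-weaken H h₁) (shape-weaken H h₂)
shape-weaken H (shape-esub h₁ h₂) = shape-esub (shape-weaken (bind-VarIncl H) h₁) (shape-weaken H h₂)

shape-forget : ∀ {m m'} {r : Scope m m'} {s s'} → Shape r (lam s) (lam s') → Shape free (lam s) (lam s')
shape-forget (shape-lam h) = shape-lam (shape-weaken (bind-VarIncl (λ _ → any-free)) h)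

sub0-SubstRel : ∀ {k k'} {v : Term k} {v' : Term k'} → Shape free v v' →
  SubstRel (bind free) free (sub0 v) (sub0 v')
sub0-SubstRel sv bound       = sv
sub0-SubstRel sv (shifted _) = shape-var any-free

shape-tr : ∀ {m} (t : Term m) → Shape free t (tr t)
shape-tr = go (λ x → any-free)
  where
  diagonal : ∀ {m} {r : Scope m m} → (∀ x → VarRel r x x) → ∀ x → VarRel (bind r) x x
  diagonal H zero    = bound
  diagonal H (suc x) = shifted (H x)
  go : ∀ {m} {r : Scope m m} → (∀ x → VarRel r x x) → ∀ t → Shape r t (tr t)
  go H (var x)    = shape-var (H x)
  go H (lam t)    = shape-lam (go (diagonal H) t)
  go H (app t u)  = shape-app (go H t) (go H u)
  go H (esub t u) = shape-esub (go (diagonal H) t) (go H u)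

-- A syntactic description of normal forms (only the direction "these terms
-- are normal" is needed).

mutual
  data Inert {n : ℕ} : Term n → Set where
    inert-app  : ∀ {f a} → Head f → Nf a → Inert (app f a)
    inert-esub : ∀ {t u} → Inert t → Inert u → Inert (esub t u)

  data Head {n : ℕ} : Term n → Set where
    head-inert : ∀ {t} → Inert t → Head t
    head-var   : ∀ {x} → Head (var x)
    head-esub  : ∀ {t u} → Head t → Inert u → Head (esub t u)

  data Nf {n : ℕ} : Term n → Set where
    nf-inert  : ∀ {t} → Inert t → Nf t
    nf-answer : ∀ {m} {L : SCtx n m} {v} → InertCtx L → Value v → Nf (plug L v)

  data InertCtx : ∀ {n m} → SCtx n m → Set where
    inert-hole : ∀ {n} → InertCtx (hole {n})
    inert-cons : ∀ {n m} {L : SCtx (suc n) m} {u : Term n} → InertCtx L → Inert u → InertCtx (L [← u ])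

inert-not-answer : ∀ {n m} (L : SCtx n m) {w} → Value w → ¬ Inert (plug L w)
inert-not-answer hole       (vvar x) ()
inert-not-answer hole       (vlam t) ()
inert-not-answer (L [← u ]) vw (inert-esub i _) = inert-not-answer L vw i

head-not-abstraction : ∀ {n m} (L : SCtx n m) {s} → ¬ Head (plug L (lam s))
head-not-abstraction hole       (head-inert ())
head-not-abstraction (L [← u ]) (head-inert (inert-esub i _)) = inert-not-answer L (vlam _) i
head-not-abstraction (L [← u ]) (head-esub f _) = head-not-abstraction L f

mutual
  inert-normal : ∀ {n k} {t u : Term n} → Inert t → ¬ Step k t u
  inert-normal (inert-app f a) (root (rootM L s _)) = head-not-abstraction L f
  inert-normal (inert-app f a) (appL st) = head-normal f st
  inert-normal (inert-app f a) (appR st) = nf-normal a st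
  inert-normal (inert-esub i j) (root (rootE _ L v vv)) = inert-not-answer L vv j
  inert-normal (inert-esub i j) (esubL st) = inert-normal i st
  inert-normal (inert-esub i j) (esubR st) = inert-normal j st

  head-normal : ∀ {n k} {t u : Term n} → Head t → ¬ Step k t u
  head-normal (head-inert i) st = inert-normal i st
  head-normal head-var (root ())
  head-normal (head-esub f j) (root (rootE _ L v vv)) = inert-not-answer L vv j
  head-normal (head-esub f j) (esubL st) = head-normal f st
  head-normal (head-esub f j) (esubR st) = inert-normal j st

  nf-normal : ∀ {n k} {t u : Term n} → Nf t → ¬ Step k t u
  nf-normal (nf-inert i) st = inert-normal i st
  nf-normal (nf-answer {L = L} ic vv) st = answer-normal L ic vv st

  answer-normal : ∀ {n m k} (L : SCtx n m) {v : Term m} {u} → InertCtx L → Value v → ¬ Step k (plug L v) u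
  answer-normal hole       inert-hole vv st = value-normal vv st
  answer-normal (L [← c ]) (inert-cons ic j) vv (root (rootE _ L₃ w vw)) = inert-not-answer L₃ vw j
  answer-normal (L [← c ]) (inert-cons ic j) vv (esubL st) = answer-normal L ic vv st
  answer-normal (L [← c ]) (inert-cons ic j) vv (esubR st) = inert-normal j st

mutual
  inert-ren : ∀ {n n'} (f : Fin n → Fin n') {t} → Inert t → Inert (ren f t)
  inert-ren f (inert-app g a)  = inert-app (head-ren f g) (nf-ren f a)
  inert-ren f (inert-esub i j) = inert-esub (inert-ren (ext f) i) (inert-ren f j)

  head-ren : ∀ {n n'} (f : Fin n → Fin n') {t} → Head t → Head (ren f t)
  head-ren f (head-inert i)  = head-inert (inert-ren f i)
  head-ren f head-var        = head-var
  head-ren f (head-esub g j) = head-esub (head-ren (ext f) g) (inert-ren f j)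

  nf-ren : ∀ {n n'} (f : Fin n → Fin n') {t} → Nf t → Nf (ren f t)
  nf-ren f (nf-inert i) = nf-inert (inert-ren f i)
  nf-ren f (nf-answer {L = L} {v = v} ic vv) =
    transport Nf (sym (ren-plug f L v)) (nf-answer (inertCtx-ren f ic) (value-ren _ vv))

  inertCtx-ren : ∀ {n n' m} (f : Fin n → Fin n') {L : SCtx n m} → InertCtx L → InertCtx (renCtx (renS f L))
  inertCtx-ren f inert-hole        = inert-hole
  inertCtx-ren f (inert-cons ic j) = inert-cons (inertCtx-ren (ext f) ic) (inert-ren f j)

inert-plug : ∀ {n m} {L : SCtx n m} {X} → InertCtx L → Inert X → Inert (plug L X)
inert-plug inert-hole        i = i
inert-plug (inert-cons ic j) i = inert-esub (inert-plug ic i) j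

head-plug-var : ∀ {n m} {L : SCtx n m} {x} → InertCtx L → Head (plug L (var x))
head-plug-var inert-hole        = head-var
head-plug-var (inert-cons ic j) = head-esub (head-plug-var ic) j

inertCtx-⊕ : ∀ {n m k} {L : SCtx n m} {L₂ : SCtx m k} → InertCtx L → InertCtx L₂ → InertCtx (L ⊕ L₂)
inertCtx-⊕ inert-hole        ic₂ = ic₂
inertCtx-⊕ (inert-cons ic j) ic₂ = inert-cons (inertCtx-⊕ ic ic₂) j

-- Every m-step of t is matched by exactly one
-- m-step of p; the extra steps of p are e-steps that fire the explicit
-- substitutions introduced by the translation pattern (p x)[x←q].

data Result {m m' : ℕ} : Term m → Term m' → Set where
  both-inert  : ∀ {a b} → Inert a → Inert b → Result a b
  both-answer : ∀ {k k'} {L : SCtx m k} {L' : SCtx m' k'} {v v'} → InertCtx L → InertCtx L' →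
                Value v → Value v' → Shape free v v' → Result (plug L v) (plug L' v')

result-nf : ∀ {m m'} {a : Term m} {b : Term m'} → Result a b → Nf a × Nf b
result-nf (both-inert a b)              = nf-inert a , nf-inert b
result-nf (both-answer ic ic' vv vv' _) = nf-answer ic vv , nf-answer ic' vv'

record Simulation {m m'} (t : Term m) (p : Term m') : Set where
  constructor simulation
  field
    {end}  : Term m
    {end'} : Term m'
    run    : Sync t end p end'
    result : Result end end'

infixr 5 _▸_
_▸_ : ∀ {m m'} {t s : Term m} {p q : Term m'} → Sync t s p q → Simulation s q → Simulation t p
prefix ▸ simulation run res = simulation (prefix ▹ run) res

simulation-plug : ∀ {m m' k k'} {L : SCtx m k} {L' : SCtx m' k'} → InertCtx L → InertCtx L' →
  ∀ {X X'} → Simulation X X' → Simulation (plug L X) (plug L' X')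
simulation-plug {L = L} {L'} ic ic' (simulation run (both-inert a b)) =
  simulation (sync-map (inPlug L) (inPlug L') run) (both-inert (inert-plug ic a) (inert-plug ic' b))
simulation-plug {L = L} {L'} ic ic' (simulation run (both-answer {L = L₃} {L₃'} {v} {v'} ic₃ ic₃' vv vv' sv)) =
  simulation (sync-≡ (sym (plug-⊕ L L₃ v)) (sym (plug-⊕ L' L₃' v')) (sync-map (inPlug L) (inPlug L') run))
             (both-answer (inertCtx-⊕ ic ic₃) (inertCtx-⊕ ic' ic₃') vv vv' sv)

IH : ℕ → Set
IH N = ∀ {N'} → N' < N → ∀ {m m'} {X : Term m} {X' : Term m'} →
  Shape free X X' → EitherBounded N' X X' → Simulation X X'

-- Since the measure decreases
-- along it, the simulation resumes on the contents by induction.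
record Phase {m m'} (s : Term m) (q : Term m') : Set where
  constructor phase
  field
    {hm hm'}     : ℕ
    {K}          : SCtx m hm
    {K'}         : SCtx m' hm'
    {X}          : Term hm
    {X'}         : Term hm'
    {end}        : Term m
    {end'}       : Term m'
    steps        : Sync s end q end'
    progress     : 0 < length (left steps)
    progress'    : 0 < length (right steps)
    K-inert      : InertCtx K
    K'-inert     : InertCtx K'
    end-plug     : end ≡ plug K X
    end'-plug    : end' ≡ plug K' X'
    contents     : Shape free X X'

resume : ∀ {N m m'} {t s : Term m} {p q : Term m'} → IH N → EitherBounded N t p →
  Sync t s p q → Phase s q → Simulation t p
resume ih B prefix (phase {K = K} {K'} steps pr pr' ic ic' refl refl sh)
  with either-advance (either-deriv B (left prefix) (right prefix)) (left steps) pr (right steps) pr'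
... | N' , lt , B' = prefix ▸ steps ▸ simulation-plug ic ic' (ih lt sh (either-unmap (inPlug K) (inPlug K') B'))

shape-contract : ∀ {m m' k k'} {r : Scope m m'} (f : Fin m → Fin k) (g : Fin m' → Fin k')
  {s s' v v'} → Shape (bind r) s s' → Shape free v v' →
  Shape free ((ren (ext f) s) ⟪ v ⟫) ((ren (ext g) s') ⟪ v' ⟫)
shape-contract f g st sv =
  shape-subst (sub0 _) (sub0 _) (sub0-SubstRel sv) (shape-ren (ext f) (ext g) (ext-VarMap (λ _ → any-free)) st)

shape-rename-bodyʳ : ∀ {m m' k'} {r : Scope m m'} (g : Fin m' → Fin k') {s s'} →
  Shape (bind r) s s' → Shape (bind free) s (ren (ext g) s')
shape-rename-bodyʳ g = shape-renʳ (ext g) related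
  where
  related : VarMap (bind _) (bind free) (λ x → x) (ext g)
  related bound       = bound
  related (shifted _) = shifted any-free

shape-instantiateʳ : ∀ {m m'} {r : Scope m m'} (j : Fin m') {s : Term (suc m)} {s'} →
  Shape (bind r) s s' → Shape free s (s' ⟪ var j ⟫)
shape-instantiateʳ j = shape-substʳ (sub0 (var j)) related
  where
  related : SubstRel (bind _) free var (sub0 (var j))
  related bound       = shape-var any-free
  related (shifted _) = shape-var any-free

weaken-instantiate : ∀ {m k} (f : Fin m → Fin k) (w : Term k) (a : Term m) →
  subst (sub0 w) (ren (ext f) (ren suc a)) ≡ ren f a
weaken-instantiate f w a =
  trans (subst-ren (sub0 w) (ext f) (ren suc a)) (trans (subst-ren _ suc a) (sym (ren-as-subst f a)))

trApp-answer : ∀ {m k} (L : SCtx m k) (P : Term m) {v} → Value v →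
  Step exs (trApp P (plug L v)) (plug L (app (ren (Lren L) P) v))
trApp-answer L P {v} vv =
  step-≡ refl (cong (λ z → plug L (app z v)) (weaken-instantiate (Lren L) v P))
         (root (rootE (app (ren suc P) (var zero)) L v vv))

translated-β : ∀ {a b m} (ρ : Fin a → Fin b) (L' : SCtx a m) (s' : Term (suc m)) {w : Term b} →
  Value w →
  let L'ᵖ = renCtx (renS ρ L')
      s'ᵖ = ren (ext (renInner (renS ρ L'))) s'
  in app (ren ρ (plug L' (lam s'))) w ⟶* plug L'ᵖ ((ren (ext (λ i → i)) s'ᵖ) ⟪ ren (Lren L'ᵖ) w ⟫)
translated-β ρ L' s' {w} vw =
  step mul (step-≡ (cong (λ z → app z w) (sym (ren-plug ρ L' (lam s')))) refl (root (rootM L'ᵖ s'ᵖ w)))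
  (step exs (step-plug L'ᵖ (root (rootE s'ᵖ hole (ren (Lren L'ᵖ) w) (value-ren _ vw)))) done)
  where
  L'ᵖ = renCtx (renS ρ L')
  s'ᵖ = ren (ext (renInner (renS ρ L'))) s'

phase-esub : ∀ {m m' k k'} {r : Scope m m'} {t p} {L : SCtx m k} {L' : SCtx m' k'} {v v'} →
  Shape (bind r) t p → InertCtx L → InertCtx L' → Value v → Value v' → Shape free v v' →
  Phase (esub t (plug L v)) (esub p (plug L' v'))
phase-esub {t = t} {p} {L} {L'} {v} {v'} st ic ic' vv vv' sv =
  phase (sync (step exs (root (rootE t L v vv)) done) (step exs (root (rootE p L' v' vv')) done) refl)
        (s≤s z≤n) (s≤s z≤n) ic ic' refl refl (shape-contract (Lren L) (Lren L') st sv)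

-- L⟨λx.s⟩ u  against  (L'⟨λx.s'⟩ y)[y←q]  with inert arguments: one m-step
-- on the left; an m-step and the e-step substituting y on the right.
phase-β-inert : ∀ {m m' k k'} {L : SCtx m k} {L' : SCtx m' k'} {s s' u q} →
  InertCtx L → InertCtx L' → Shape (bind free) s s' → Inert u → Inert q →
  Phase (app (plug L (lam s)) u) (trApp (plug L' (lam s')) q)
phase-β-inert {L = L} {L'} {s} {s'} {u} {q} ic ic' sh iu iq =
  phase (sync (step mul (root (rootM L s u)) done) (map-deriv (inEsubL q) (translated-β suc L' s' (vvar zero))) refl)
        (s≤s z≤n) (s≤s z≤n)
        (inertCtx-⊕ ic (inert-cons inert-hole (inert-ren (Lren L) iu)))
        (inert-cons (inertCtx-ren suc ic') iq)
        (sym (plug-⊕ L (hole [← ren (Lren L) u ]) s)) refl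
        (shape-instantiateʳ _ (shape-rename-bodyʳ _ (shape-rename-bodyʳ _ sh)))

-- L⟨λx.s⟩ L₂⟨v⟩  against  (L'⟨λx.s'⟩ y)[y←L₂'⟨v'⟩]: an m-step and an e-step on
-- the left; on the right the e-step moving L₂' out, then an m-step and an e-step.
phase-β-answer : ∀ {m m' k k' k₂ k₂'} {L : SCtx m k} {L' : SCtx m' k'} {L₂ : SCtx m k₂} {L₂' : SCtx m' k₂'}
  {s s' v v'} → InertCtx L → InertCtx L' → Shape (bind free) s s' →
  InertCtx L₂ → InertCtx L₂' → Value v → Value v' → Shape free v v' →
  Phase (app (plug L (lam s)) (plug L₂ v)) (trApp (plug L' (lam s')) (plug L₂' v'))
phase-β-answer {L = L} {L'} {L₂} {L₂'} {s} {s'} {v} {v'} ic ic' sh ic₂ ic₂' vv vv' sv =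
  phase (sync (step mul (root (rootM L s (plug L₂ v))) (step exs exsL done))
              (step exs (trApp-answer L₂' (plug L' (lam s')) vv')
                    (map-deriv (inPlug L₂') (translated-β (Lren L₂') L' s' vv')))
              refl)
        (s≤s z≤n) (s≤s z≤n)
        (inertCtx-⊕ ic (inertCtx-ren (Lren L) ic₂)) (inertCtx-⊕ ic₂' (inertCtx-ren (Lren L₂') ic'))
        (sym (plug-⊕ L L₂ᵖ _)) (sym (plug-⊕ L₂' L'ᵖ _))
        (shape-contract (Lren L₂ᵖ) (λ i → i) (shape-rename-bodyʳ _ sh)
           (shape-ren (renInner R₂) (Lren L'ᵖ) (λ _ → any-free) sv))
  where
  R₂  = renS (Lren L) L₂
  L₂ᵖ = renCtx R₂
  L'ᵖ = renCtx (renS (Lren L₂') L')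
  exsL : Step exs (plug L (esub s (ren (Lren L) (plug L₂ v))))
                  (plug L (plug L₂ᵖ ((ren (ext (Lren L₂ᵖ)) s) ⟪ ren (renInner R₂) v ⟫)))
  exsL = step-≡ (cong (λ z → plug L (esub s z)) (sym (ren-plug (Lren L) L₂ v))) refl
                (step-plug L (root (rootE s L₂ᵖ (ren (renInner R₂) v) (value-ren _ vv))))

data HeadResult {m m' : ℕ} : Term m → Term m' → Set where
  stuck       : ∀ {a b} → Head a → Head b → HeadResult a b
  abstraction : ∀ {k k'} {L : SCtx m k} {L' : SCtx m' k'} {s s'} → InertCtx L → InertCtx L' →
                Shape (bind free) s s' → HeadResult (plug L (lam s)) (plug L' (lam s'))

head-result : ∀ {m m'} {a : Term m} {b : Term m'} → Result a b → HeadResult a b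
head-result (both-inert a b)                                      = stuck (head-inert a) (head-inert b)
head-result (both-answer ic ic' (vvar _) _ (shape-var _))         = stuck (head-plug-var ic) (head-plug-var ic')
head-result (both-answer ic ic' (vlam _) (vlam _) (shape-lam h))  = abstraction ic ic' h

simulate-app-results : ∀ {N m m'} {t u nt nu : Term m} {p q np nq : Term m'} → IH N →
  EitherBounded N (app t u) (trApp p q) → Sync (app t u) (app nt nu) (trApp p q) (trApp np nq) →
  HeadResult nt np → Result nu nq → Simulation (app t u) (trApp p q)
simulate-app-results ih B prefix (stuck h h') (both-inert iu iq) =
  simulation prefix
    (both-inert (inert-app h (nf-inert iu))
                (inert-esub (inert-app (head-ren suc h') (nf-answer inert-hole (vvar zero))) iq))
simulate-app-results {np = np} ih B prefix (stuck h h') (both-answer {L' = L₂'} ic₂ ic₂' vv vv' _) =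
  prefix ▸ simulation (sync done (step exs (trApp-answer L₂' np vv') done) refl)
    (both-inert (inert-app h (nf-answer ic₂ vv))
                (inert-plug ic₂' (inert-app (head-ren _ h') (nf-answer inert-hole vv'))))
simulate-app-results ih B prefix (abstraction ic ic' sh) (both-inert iu iq) =
  resume ih B prefix (phase-β-inert ic ic' sh iu iq)
simulate-app-results ih B prefix (abstraction ic ic' sh) (both-answer ic₂ ic₂' vv vv' sv) =
  resume ih B prefix (phase-β-answer ic ic' sh ic₂ ic₂' vv vv' sv)

inTrHead : ∀ {m} → Term m → StepMap m m
inTrHead q = stepMap (λ x → trApp x q) (λ s → esubL (appL (step-ren suc s)))

simulate-app : ∀ {N m m'} {t u : Term m} {p q : Term m'} → IH N →
  (∀ {nu nq} → EitherBounded N (app t nu) (trApp p nq) → Simulation t p) →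
  EitherBounded N (app t u) (trApp p q) → Simulation u q → Simulation (app t u) (trApp p q)
simulate-app {t = t} {u} {p} {q} ih head B (simulation {nu} {nq} runᵤ resᵤ) =
  continue (head (either-deriv B (left argument) (right argument)))
  where
  argument : Sync (app t u) (app t nu) (trApp p q) (trApp p nq)
  argument = sync-map (inAppR t) (inEsubR (app (ren suc p) (var zero))) runᵤ
  continue : Simulation t p → Simulation (app t u) (trApp p q)
  continue (simulation runₜ resₜ) =
    simulate-app-results ih B (argument ▹ sync-map (inAppL nu) (inTrHead nq) runₜ) (head-result resₜ) resᵤ

simulate-esub : ∀ {N m m'} {r : Scope m m'} {t : Term (suc m)} {p : Term (suc m')} {u : Term m} {q : Term m'} →
  IH N → Shape (bind r) t p →
  (∀ {nu nq} → EitherBounded N (esub t nu) (esub p nq) → Simulation t p) →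
  EitherBounded N (esub t u) (esub p q) → Simulation u q → Simulation (esub t u) (esub p q)
simulate-esub {t = t} {p} {u} {q} ih st body B (simulation {nu} {nq} runᵤ (both-inert iu iq)) =
  continue (body (either-deriv B (left argument) (right argument)))
  where
  argument : Sync (esub t u) (esub t nu) (esub p q) (esub p nq)
  argument = sync-map (inEsubR t) (inEsubR p) runᵤ
  under-inert : ∀ {a b} → Result a b → Result (esub a nu) (esub b nq)
  under-inert (both-inert a b)               = both-inert (inert-esub a iu) (inert-esub b iq)
  under-inert (both-answer ic ic' vv vv' sv) = both-answer (inert-cons ic iu) (inert-cons ic' iq) vv vv' sv
  continue : Simulation t p → Simulation (esub t u) (esub p q)
  continue (simulation runₜ resₜ) =
    argument ▸ simulation (sync-map (inEsubL nu) (inEsubL nq) runₜ) (under-inert resₜ)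
simulate-esub {t = t} {p} ih st body B (simulation runᵤ (both-answer ic ic' vv vv' sv)) =
  resume ih B (sync-map (inEsubR t) (inEsubR p) runᵤ) (phase-esub st ic ic' vv vv' sv)

simulate : ∀ N → Acc _<_ N → ∀ {m m'} {r : Scope m m'} {t : Term m} {p : Term m'} →
  Shape r t p → EitherBounded N t p → Simulation t p
simulate N _ (shape-var h) B =
  simulation (sync done done refl) (both-answer inert-hole inert-hole (vvar _) (vvar _) (shape-var any-free))
simulate N _ (shape-lam h) B =
  simulation (sync done done refl) (both-answer inert-hole inert-hole (vlam _) (vlam _) (shape-forget (shape-lam h)))
simulate N (acc smaller) (shape-esub {t = t} {p = p} st su) B =
  simulate-esub (λ lt → simulate _ (smaller lt)) st
    (λ B' → simulate N (acc smaller) st (either-unmap (inEsubL _) (inEsubL _) B'))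
    B (simulate N (acc smaller) su (either-unmap (inEsubR t) (inEsubR p) B))
simulate N (acc smaller) (shape-app {t = t} {p = p} st su) B =
  simulate-app (λ lt → simulate _ (smaller lt))
    (λ B' → simulate N (acc smaller) st (either-unmap (inAppL _) (inTrHead _) B'))
    B (simulate N (acc smaller) su (either-unmap (inAppR t) (inEsubR (app (ren suc p) (var zero))) B))

mutual
  isK-ren : ∀ {n n'} (f : Fin n → Fin n') {t} → IsK t → IsK (ren f t)
  isK-ren f (kval kv)     = kval (isKV-ren f kv)
  isK-ren f (kapp k kv)   = kapp (isK-ren f k) (isKV-ren f kv)
  isK-ren f (kesub k₁ k₂) = kesub (isK-ren (ext f) k₁) (isK-ren f k₂)

  isKV-ren : ∀ {n n'} (f : Fin n → Fin n') {t} → IsKV t → IsKV (ren f t)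
  isKV-ren f (kvar x) = kvar (f x)
  isKV-ren f (klam k) = klam (isK-ren (ext f) k)

KSubst : ∀ {n m} → (Fin n → Term m) → Set
KSubst σ = ∀ i → IsKV (σ i)

exts-KSubst : ∀ {n m} {σ : Fin n → Term m} → KSubst σ → KSubst (exts σ)
exts-KSubst h zero    = kvar zero
exts-KSubst h (suc i) = isKV-ren suc (h i)

mutual
  isK-subst : ∀ {n m} {σ : Fin n → Term m} → KSubst σ → ∀ {t} → IsK t → IsK (subst σ t)
  isK-subst h (kval kv)     = kval (isKV-subst h kv)
  isK-subst h (kapp k kv)   = kapp (isK-subst h k) (isKV-subst h kv)
  isK-subst h (kesub k₁ k₂) = kesub (isK-subst (exts-KSubst h) k₁) (isK-subst h k₂)

  isKV-subst : ∀ {n m} {σ : Fin n → Term m} → KSubst σ → ∀ {t} → IsKV t → IsKV (subst σ t)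
  isKV-subst h (kvar x) = h x
  isKV-subst h (klam k) = klam (isK-subst (exts-KSubst h) k)

data KCtx : ∀ {n m} → SCtx n m → Set where
  khole : ∀ {n} → KCtx (hole {n})
  kcons : ∀ {n m} {L : SCtx (suc n) m} {u : Term n} → KCtx L → IsK u → KCtx (L [← u ])

isK-unplug : ∀ {n m} (L : SCtx n m) {X} → IsK (plug L X) → KCtx L × IsK X
isK-unplug hole       k = khole , k
isK-unplug (L [← u ]) (kval ())
isK-unplug (L [← u ]) (kesub k₁ k₂) with isK-unplug L k₁
... | kL , kX = kcons kL k₂ , kX

isK-plug : ∀ {n m} {L : SCtx n m} {X} → KCtx L → IsK X → IsK (plug L X)
isK-plug khole         k = k
isK-plug (kcons kL ku) k = kesub (isK-plug kL k) ku

isKV-normal : ∀ {n k} {v u : Term n} → IsKV v → ¬ Step k v u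
isKV-normal (kvar x) (root ())
isKV-normal (klam _) (root ())

isK-step : ∀ {n k} {t u : Term n} → IsK t → Step k t u → IsK u
isK-step (kval kv) st = ⊥-elim (isKV-normal kv st)
isK-step (kapp kt kv) (root (rootM L s u)) with isK-unplug L kt
... | kL , kval (klam ks) = isK-plug kL (kesub ks (kval (isKV-ren (Lren L) kv)))
isK-step (kapp kt kv) (appL st) = kapp (isK-step kt st) kv
isK-step (kapp kt kv) (appR st) = ⊥-elim (isKV-normal kv st)
isK-step (kesub kt ku) (root (rootE t L v vv)) with isK-unplug L ku
... | kL , kval kv = isK-plug kL (isK-subst (substituted-value kv) (isK-ren (ext (Lren L)) kt))
  where
  substituted-value : IsKV v → KSubst (sub0 v)
  substituted-value kv zero    = kv
  substituted-value kv (suc i) = kvar i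
isK-step (kesub kt ku) (esubL st) = kesub (isK-step kt st) ku
isK-step (kesub kt ku) (esubR st) = kesub kt (isK-step ku st)

isK-tr : ∀ {n} (t : Term n) → IsK (tr t)
isK-tr (var x)    = kval (kvar x)
isK-tr (lam t)    = kval (klam (isK-tr t))
isK-tr (app t u)  = kesub (kapp (isK-ren suc (isK-tr t)) (kvar zero)) (isK-tr u)
isK-tr (esub t u) = kesub (isK-tr t) (isK-tr u)

deriv→K : ∀ {n} {t s : Term n} → IsK t → (d : t ⟶* s) → Σ (Deriv VSubK t s) λ e → countM e ≡ countM d
deriv→K kt done = done , refl
deriv→K kt (step k st d) with deriv→K (isK-step kt st) d
... | e , c = step k (kt , isK-step kt st , st) e ,
  trans (countM-step k _ e) (trans (cong (weight k +_) c) (sym (countM-step k st d)))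

K→deriv : ∀ {n} {t s : Term n} → (e : Deriv VSubK t s) → Σ (t ⟶* s) λ d → countM d ≡ countM e
K→deriv done = done , refl
K→deriv (step k (_ , _ , st) e) with K→deriv e
... | d , c = step k st d , trans (countM-step k st d) (trans (cong (weight k +_) c) (sym (countM-step k _ e)))

K-target : ∀ {n} {t s : Term n} → IsK t → Deriv VSubK t s → IsK s
K-target kt done                   = kt
K-target kt (step k (_ , ku , _) e) = K-target ku e

normalK→normal : ∀ {n} {s : Term n} → IsK s → Normal VSubK s → Normal VSub s
normalK→normal ks nk k u st = nk k u (ks , isK-step ks st , st)

normal→normalK : ∀ {n} {s : Term n} → Normal VSub s → Normal VSubK s
normal→normalK nv k u (_ , _ , st) = nv k u st

nf-Normal : ∀ {n} {t : Term n} → Nf t → Normal VSub t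
nf-Normal x k u = nf-normal x

simulate-tr : ∀ {n} (t : Term n) N → EitherBounded N t (tr t) → Simulation t (tr t)
simulate-tr t N = simulate N (<-wellFounded N) (shape-tr t)

simulation-from-vsub : ∀ {n} (t : Term n) → NormDeriv VSub t → Simulation t (tr t)
simulation-from-vsub t (_ , d , ns) = simulate-tr t (length d) (inj₁ (normalizing⇒bounded d ns))

simulation-from-vsubK : ∀ {n} (t : Term n) → NormDeriv VSubK (tr t) → Simulation t (tr t)
simulation-from-vsubK t (_ , e , ns) =
  simulate-tr t (length d) (inj₂ (normalizing⇒bounded d (normalK→normal (K-target (isK-tr t) e) ns)))
  where d = proj₁ (K→deriv e)

simulation-vsub : ∀ {n} {t : Term n} → Simulation t (tr t) → NormDeriv VSub t
simulation-vsub (simulation run res) = _ , left run , nf-Normal (proj₁ (result-nf res))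

simulation-vsubK : ∀ {n} (t : Term n) → Simulation t (tr t) → NormDeriv VSubK (tr t)
simulation-vsubK t (simulation run res) =
  _ , proj₁ (deriv→K (isK-tr t) (right run)) , normal→normalK (nf-Normal (proj₂ (result-nf res)))

-- By uniqueness of m-counts on each side, the synchronization of the
-- simulation transfers to arbitrary normalizing derivations.
simulation-countM : ∀ {n} {t : Term n} → Simulation t (tr t) → ∀ {s s'} (d : t ⟶* s) (e : Deriv VSubK (tr t) s') →
  Normal VSub s → Normal VSubK s' → countM d ≡ countM e
simulation-countM {t = t} (simulation run res) d e ns ns' = begin
  countM d           ≡⟨ countM-unique d (left run) ns (nf-Normal (proj₁ (result-nf res))) ⟩
  countM (left run)  ≡⟨ same-m run ⟩
  countM (right run) ≡⟨ countM-unique (right run) e' (nf-Normal (proj₂ (result-nf res))) ns'ᵥ ⟩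
  countM e'          ≡⟨ proj₂ (K→deriv e) ⟩
  countM e           ∎
  where
  open ≡-Reasoning
  e'   = proj₁ (K→deriv e)
  ns'ᵥ = normalK→normal (K-target (isK-tr t) e) ns'

corollary4 : ∀ {n} (t : Term n) →
    ((NormDeriv VSub t → NormDeriv VSubK (tr t)) ×
     (NormDeriv VSubK (tr t) → NormDeriv VSub t)) ×
    (∀ {s s'} (d : Deriv VSub t s) (e : Deriv VSubK (tr t) s') →
       Normal VSub s → Normal VSubK s' → countM d ≡ countM e)
corollary4 t =
  ( (λ nd → simulation-vsubK t (simulation-from-vsub t nd))
  , (λ ne → simulation-vsub (simulation-from-vsubK t ne)) )
  , λ d e ns ns' → simulation-countM (simulation-from-vsub t (_ , d , ns)) d e ns ns'
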